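{- Let $k$ be a positive integer. For a positive integer $n$ and $r,s\in\mathbb N_0$, the following conditions are equivalent: (i) $k^2+1\le n\le k^2+k$, $r\le s$, $rs=n$, and $r+s\le 2k+1$; (ii) $k^2+1\le n\le k^2+k$, $r\le s$, $rs=n$, and $r+s=2k+1$; (iii) there is $l\in\mathbb N_0$ such that $l^2+l\le k-1$, $n=k^2+k-l^2-l$, $r=k-l$ and $s=k+l+1$.
   Context: $\mathbb N_0$ denotes the set of non-negative integers. -}

module Defs where

open import Data.Nat using (ℕ; _+_; _*_; _∸_; _≤_)
open import Data.Product using (_×_; ∃-syntax)
open import Relation.Binary.PropositionalEquality using (_≡_)

CondI : ℕ → ℕ → ℕ → ℕ → Set
CondI k n r s =
  (k * k + 1 ≤ n × n ≤ k * k + k) × r ≤ s × r * s ≡ n × r + s ≤ 2 * k + 1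

CondII : ℕ → ℕ → ℕ → ℕ → Set
CondII k n r s =
  (k * k + 1 ≤ n × n ≤ k * k + k) × r ≤ s × r * s ≡ n × r + s ≡ 2 * k + 1

-- Condition (iii); subtraction is truncated but l * l + l ≤ k - 1 ensures
-- k * k + k ≥ l * l + l, and k ≥ l, so it is exact.
CondIII : ℕ → ℕ → ℕ → ℕ → Set
CondIII k n r s = ∃[ l ]
  (l * l + l ≤ k ∸ 1 × n ≡ (k * k + k) ∸ (l * l + l) × r ≡ k ∸ l × s ≡ k + l + 1)

-- Writing k = r + l and s = k + l + 1 gives the identity k² + k = r s + (l² + l), which
-- turns the bounds k² < n ≤ k² + k on n = r s into l² + l < k. Conversely, if r s > k² then
-- r + s > 2k, since 4 r s ≤ (r + s)²; so under (i) the sum r + s is exactly 2k + 1, and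
-- r ≤ s forces r ≤ k, which is where l = k - r comes from.
module Submission where

open import Defs
open import Data.Nat using (ℕ; NonZero; suc; _+_; _*_; _∸_; _≤_; _<_)
open import Data.Nat.Properties
open import Data.Nat.Solver using (module +-*-Solver)
open import Data.Product using (_×_; _,_)
open import Data.Sum using (inj₁; inj₂)
open import Function.Bundles using (_⇔_; mk⇔; Equivalence)
open import Relation.Binary.PropositionalEquality
open +-*-Solver

m≤n⇒4*m*n≤[m+n]² : ∀ {m n} → m ≤ n → 4 * (m * n) ≤ (m + n) * (m + n)
m≤n⇒4*m*n≤[m+n]² {m} m≤n with m≤n⇒∃[o]m+o≡n m≤n
... | d , refl = subst (4 * (m * (m + d)) ≤_) (sym square) (m≤m+n _ (d * d))
  where
  square : (m + (m + d)) * (m + (m + d)) ≡ 4 * (m * (m + d)) + d * d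
  square = solve 2 (λ m d → (m :+ (m :+ d)) :* (m :+ (m :+ d))
                         := con 4 :* (m :* (m :+ d)) :+ d :* d) refl m d

4*m*n≤[m+n]² : ∀ m n → 4 * (m * n) ≤ (m + n) * (m + n)
4*m*n≤[m+n]² m n with ≤-total m n
... | inj₁ m≤n = m≤n⇒4*m*n≤[m+n]² m≤n
... | inj₂ n≤m = subst₂ _≤_ (cong (4 *_) (*-comm n m)) (cong₂ _*_ (+-comm n m) (+-comm n m))
                        (m≤n⇒4*m*n≤[m+n]² n≤m)

k²<m*n⇒2k<m+n : ∀ k m n → k * k < m * n → 2 * k < m + n
k²<m*n⇒2k<m+n k m n k²<mn = ≰⇒> λ m+n≤2k → <⇒≱ k²<mn (*-cancelˡ-≤ 4 (begin
  4 * (m * n)       ≤⟨ 4*m*n≤[m+n]² m n ⟩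
  (m + n) * (m + n) ≤⟨ *-mono-≤ m+n≤2k m+n≤2k ⟩
  2 * k * (2 * k)   ≡⟨ solve 1 (λ k → con 2 :* k :* (con 2 :* k) := con 4 :* (k :* k)) refl k ⟩
  4 * (k * k)       ∎))
  where open ≤-Reasoning

m≤n⇒m+n≡2k+1⇒m≤k : ∀ {m n k} → m ≤ n → m + n ≡ 2 * k + 1 → m ≤ k
m≤n⇒m+n≡2k+1⇒m≤k {m} {n} {k} m≤n m+n≡2k+1 = ≤-pred (*-cancelˡ-< 2 m (suc k) (begin-strict
  2 * m     ≡⟨ solve 1 (λ m → con 2 :* m := m :+ m) refl m ⟩
  m + m     ≤⟨ +-monoʳ-≤ m m≤n ⟩
  m + n     ≡⟨ m+n≡2k+1 ⟩
  2 * k + 1 <⟨ ≤-reflexive (solve 1 (λ k → con 1 :+ (con 2 :* k :+ con 1)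
                                       := con 2 :* (con 1 :+ k)) refl k) ⟩
  2 * suc k ∎))
  where open ≤-Reasoning

[r+l]²+[r+l]≡r*[r+l+l+1]+[l²+l] : ∀ r l →
  (r + l) * (r + l) + (r + l) ≡ r * (r + l + l + 1) + (l * l + l)
[r+l]²+[r+l]≡r*[r+l+l+1]+[l²+l] = solve 2 (λ r l →
  (r :+ l) :* (r :+ l) :+ (r :+ l) := r :* (r :+ l :+ l :+ con 1) :+ (l :* l :+ l)) refl

r+[r+l+l+1]≡2[r+l]+1 : ∀ r l → r + (r + l + l + 1) ≡ 2 * (r + l) + 1
r+[r+l+l+1]≡2[r+l]+1 = solve 2 (λ r l →
  r :+ (r :+ l :+ l :+ con 1) := con 2 :* (r :+ l) :+ con 1) refl

[r+l]²+[r+l]∸[l²+l]≡r*[r+l+l+1] : ∀ r l →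
  (r + l) * (r + l) + (r + l) ∸ (l * l + l) ≡ r * (r + l + l + 1)
[r+l]²+[r+l]∸[l²+l]≡r*[r+l+l+1] r l =
  trans (cong (_∸ (l * l + l)) ([r+l]²+[r+l]≡r*[r+l+l+1]+[l²+l] r l))
        (m+n∸n≡m (r * (r + l + l + 1)) (l * l + l))

r*[r+l+l+1]≤[r+l]²+[r+l] : ∀ r l → r * (r + l + l + 1) ≤ (r + l) * (r + l) + (r + l)
r*[r+l+l+1]≤[r+l]²+[r+l] r l =
  subst (r * (r + l + l + 1) ≤_) (sym ([r+l]²+[r+l]≡r*[r+l+l+1]+[l²+l] r l)) (m≤m+n _ _)

[r+l]²<r*[r+l+l+1]⇔l²+l<r+l : ∀ r l →
  (r + l) * (r + l) + 1 ≤ r * (r + l + l + 1) ⇔ l * l + l < r + l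
[r+l]²<r*[r+l+l+1]⇔l²+l<r+l r l = mk⇔
  (λ lower → +-cancelˡ-≤ k² _ _ (begin
    k² + (1 + x)  ≡⟨ +-assoc k² 1 x ⟨
    k² + 1 + x    ≤⟨ +-monoˡ-≤ x lower ⟩
    r * s + x     ≡⟨ identity ⟨
    k² + (r + l)  ∎))
  (λ x<k → +-cancelʳ-≤ x _ _ (begin
    k² + 1 + x    ≡⟨ +-assoc k² 1 x ⟩
    k² + (1 + x)  ≤⟨ +-monoʳ-≤ k² x<k ⟩
    k² + (r + l)  ≡⟨ identity ⟩
    r * s + x     ∎))
  where
  open ≤-Reasoning
  k² = (r + l) * (r + l)
  s = r + l + l + 1
  x = l * l + l
  identity = [r+l]²+[r+l]≡r*[r+l+l+1]+[l²+l] r l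

I⇒II : ∀ k n r s → CondI k n r s → CondII k n r s
I⇒II k n r s (bounds@(lower , _) , r≤s , refl , r+s≤2k+1) =
  bounds , r≤s , refl , ≤-antisym r+s≤2k+1 (subst (_≤ r + s) (+-comm 1 (2 * k)) 2k<r+s)
  where
  2k<r+s : 2 * k < r + s
  2k<r+s = k²<m*n⇒2k<m+n k r s (subst (_≤ r * s) (+-comm (k * k) 1) lower)

II⇒I : ∀ k n r s → CondII k n r s → CondI k n r s
II⇒I k n r s (bounds , r≤s , rs≡n , r+s≡2k+1) = bounds , r≤s , rs≡n , ≤-reflexive r+s≡2k+1

II⇒III : ∀ k n r s → CondII k n r s → CondIII k n r s
II⇒III k n r s ((lower , _) , r≤s , refl , r+s≡2k+1)
  with m≤n⇒∃[o]m+o≡n {n = k} (m≤n⇒m+n≡2k+1⇒m≤k r≤s r+s≡2k+1)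
... | l , refl with +-cancelˡ-≡ r s _ (trans r+s≡2k+1 (sym (r+[r+l+l+1]≡2[r+l]+1 r l)))
... | refl =
  l , <⇒≤pred (Equivalence.to ([r+l]²<r*[r+l+l+1]⇔l²+l<r+l r l) lower)
    , sym ([r+l]²+[r+l]∸[l²+l]≡r*[r+l+l+1] r l) , sym (m+n∸n≡m r l) , refl

parameters⇒II : ∀ {k n r} l → r + l ≡ k → l * l + l < k → n ≡ k * k + k ∸ (l * l + l) →
                CondII k n r (k + l + 1)
parameters⇒II {n = n} {r} l refl l²+l<k n≡ =
  ( subst (_ ≤_) (sym n≡r*s) (Equivalence.from ([r+l]²<r*[r+l+l+1]⇔l²+l<r+l r l) l²+l<k)
  , subst (_≤ _) (sym n≡r*s) (r*[r+l+l+1]≤[r+l]²+[r+l] r l) )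
  , ≤-trans (m≤m+n r l) (≤-trans (m≤m+n (r + l) l) (m≤m+n (r + l + l) 1))
  , sym n≡r*s
  , r+[r+l+l+1]≡2[r+l]+1 r l
  where
  n≡r*s : n ≡ r * (r + l + l + 1)
  n≡r*s = trans n≡ ([r+l]²+[r+l]∸[l²+l]≡r*[r+l+l+1] r l)

III⇒II : ∀ k → .{{_ : NonZero k}} → ∀ n r s → CondIII k n r s → CondII k n r s
III⇒II k n r s (l , l²+l≤pred[k] , n≡ , r≡k∸l , refl) = parameters⇒II l r+l≡k l²+l<k n≡
  where
  l²+l<k : l * l + l < k
  l²+l<k = m≤pred[n]⇒suc[m]≤n l²+l≤pred[k]
  r+l≡k : r + l ≡ k
  r+l≡k = trans (cong (_+ l) r≡k∸l) (m∸n+n≡m (≤-trans (m≤n+m l (l * l)) (<⇒≤ l²+l<k)))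

lemma6p6 : (k : ℕ) → .{{_ : NonZero k}} → (n : ℕ) → .{{_ : NonZero n}} → (r s : ℕ) →
    (CondI k n r s ⇔ CondII k n r s) × (CondII k n r s ⇔ CondIII k n r s)
lemma6p6 k n r s = mk⇔ (I⇒II k n r s) (II⇒I k n r s) , mk⇔ (II⇒III k n r s) (III⇒II k n r s)
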